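{- Let $n=dk$ with $d,k$ positive integers and let $\tau=\gamma_n^{ -k}$, where $\gamma_n=(1,2,\dots,n)$. Let $\sigma\in C_{S_n}(\tau)$. Then there exist unique $\rho\in S_k$ and $e_1,\ldots,e_k\in\{0,\ldots,d-1\}$ such that \[ \sigma=\tau_1^{e_1}\cdots\tau_k^{e_k}\hat\rho, \] and, if $E_0$ denotes the number of $r\in[k]$ such that $e_r=0$ and $r\in{\rm Exc}(\rho)$, then \[ {\rm exc}(\sigma)=dE_0+\sum_{i=1}^ke_i. \]
   Context: Permutations act on the right ($i\sigma$), and products are composed left to right: $i(\alpha\beta)=(i\alpha)\beta$. ${\rm Exc}(\sigma)=\{i\in[m-1]:i\sigma>i\}$ for $\sigma\in S_m$, and ${\rm exc}(\sigma)=|{\rm Exc}(\sigma)|$. Explicitly, $i\tau=i-k$ if $i>k$ and $i\tau=i-k+n$ if $i\le k$; $\tau$ has cycle type $d^k$ and $\tau=\tau_1\cdots\tau_k$, where $\tau_i$ is the $d$-cycle acting as $\tau$ on $X_i=\{j\in[n]: j\equiv i \pmod k\}$ and fixing all other points. For $\rho\in S_k$, $\hat\rho\in S_n$ is the permutation mapping $r+qk$ to $r\rho+qk$ for $r\in[k]$, $q\in\{0,\dots,d-1\}$. $C_{S_n}(\tau)$ is the centralizer of $\tau$ in $S_n$. -}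

module Defs where

open import Data.Nat using (ℕ; zero; suc; _+_; _*_; _∸_; _<?_; NonZero)
open import Data.Nat.Properties using (m*n≢0)
open import Data.Nat.DivMod using (_mod_; _%_)
open import Data.Fin using (Fin; toℕ; combine; remQuot; _≟_)
open import Data.Fin.Permutation using (Permutation′; _⟨$⟩ʳ_)
open import Data.List using (List; allFin; filter; length; foldr; map)
open import Data.Nat.ListAction using (sum)
open import Data.Product using (_×_; _,_)
open import Relation.Nullary using (_×-dec_)
open import Relation.Binary.PropositionalEquality using (_≡_)

-- Conventions: the point i ∈ [m] = {1,…,m} is represented by the element
-- i-1 of Fin m.  Hence "iσ > i" is "toℕ (σ i) > toℕ i".

infixr 9 _⨾_
_⨾_ : {A : Set} → (A → A) → (A → A) → (A → A)
(f ⨾ g) x = g (f x)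

_^ᶠ_ : {A : Set} → (A → A) → ℕ → (A → A)
(f ^ᶠ zero) x = x
(f ^ᶠ suc e) x = (f ^ᶠ e) (f x)

Exc : (m : ℕ) → Permutation′ m → List (Fin m)
Exc m σ = filter (λ i → toℕ i <? toℕ (σ ⟨$⟩ʳ i)) (allFin m)

exc : (m : ℕ) → Permutation′ m → ℕ
exc m σ = length (Exc m σ)

module _ (d k : ℕ) .{{_ : NonZero d}} .{{_ : NonZero k}} where

  private
    instance
      nz : NonZero (d * k)
      nz = m*n≢0 d k

  -- n = d k
  -- τ = γ_n^{-k}:  iτ = i - k (i > k),  iτ = i - k + n (i ≤ k), i.e. i ↦ i - k mod n
  τ : Fin (d * k) → Fin (d * k)
  τ j = (toℕ j + (d * k ∸ k)) mod (d * k)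

  τᵢ : Fin k → Fin (d * k) → Fin (d * k)
  τᵢ r j with toℕ j % k Data.Nat.≟ toℕ r
  ... | Relation.Nullary.yes _ = τ j
  ... | Relation.Nullary.no  _ = j

  -- ρ̂ : r + q k ↦ rρ + q k   (combine q r = q * k + r)
  hat : Permutation′ k → Fin (d * k) → Fin (d * k)
  hat ρ j with remQuot {d} k j
  ... | (q , r) = combine q (ρ ⟨$⟩ʳ r)

  -- τ_1^{e_1} ⋯ τ_k^{e_k} ρ̂  (product composed left to right)
  decomp : (Fin k → Fin d) → Permutation′ k → Fin (d * k) → Fin (d * k)
  decomp e ρ = foldr (λ r acc → (τᵢ r ^ᶠ toℕ (e r)) ⨾ acc) (λ x → x) (allFin k) ⨾ hat ρ

  InCentralizer : Permutation′ (d * k) → Set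
  InCentralizer σ = ∀ x → τ (σ ⟨$⟩ʳ x) ≡ σ ⟨$⟩ʳ (τ x)

  E₀ : (Fin k → Fin d) → Permutation′ k → ℕ
  E₀ e ρ = length (filter (λ r → (toℕ (e r) Data.Nat.≟ 0) ×-dec (toℕ r <? toℕ (ρ ⟨$⟩ʳ r))) (allFin k))

  sumE : (Fin k → Fin d) → ℕ
  sumE e = sum (map (λ r → toℕ (e r)) (allFin k))

module Submission where

-- Write the points of [n], n = d k, as pairs (q , r) ∈ [d] × [k]
-- via  combine q r = k q + r  (the point r + q k of the paper, shifted by 1).
-- In these coordinates τ acts as (q , r) ↦ (q⁻ , r), where q⁻ is the cyclic
-- predecessor of q in Fin d, τᵣ acts in the same way but only on the column
-- r, and ρ̂ acts as (q , r) ↦ (q , rρ).  Hence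
--     (q , r) · τ_1^{e_1} ⋯ τ_k^{e_k} ρ̂  =  (q⁻ᵉʳ , rρ),               (★)
-- where q⁻ᵉ is the e-fold cyclic predecessor.
--   * Existence: a map commuting with τ is determined by its values on the
--     row q = 0, and (0 , r) ↦ (q_r , r′) forces the form (★) with
--     e_r the unique exponent with 0⁻ᵉʳ = q_r and rρ = r′; applying the
--     same construction to σ⁻¹ shows that ρ is a permutation.
--   * Uniqueness: (★) evaluated on the row q = 0 recovers e and ρ.
--   * Counting: by (★) an excedance (q , r) stays in column r and only moves
--     its row; summing column by column, column r contributes d · [r < rρ]
--     if e_r = 0 and exactly e_r (the rows q < e_r, which wrap around)
--     otherwise.

open import Defs
open import Data.Nat using (ℕ; zero; suc; _+_; _*_; _∸_; _<_; _≤_; _<?_; z≤n; s≤s; s<s⁻¹; NonZero)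
  renaming (_≟_ to _≟ℕ_)
open import Data.Nat.Properties
open import Data.Nat.DivMod using (_%_; [m+n]%n≡m%n; [m+kn]%n≡m%n; m<n⇒m%n≡m)
open import Data.Fin using (Fin; zero; suc; toℕ; combine; remQuot; fromℕ; inject₁; opposite; _↑ˡ_; _↑ʳ_)
open import Data.Fin.Properties using (toℕ-injective; toℕ-combine; remQuot-combine; combine-remQuot; combine-injective; combine-surjective; combine-monoˡ-<; toℕ-fromℕ; toℕ-inject₁; toℕ-fromℕ<; toℕ<n; opposite-prop)
open import Data.Fin.Permutation using (Permutation′; _⟨$⟩ʳ_; _⟨$⟩ˡ_; permutation; inverseˡ; inverseʳ)
open import Data.List using (List; []; _∷_; allFin; filter; length; foldr; map; tabulate)
open import Data.List.Properties using (map-tabulate)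
import Data.Nat.ListAction as List
open import Data.Product using (Σ; _×_; _,_; proj₁; proj₂)
open import Relation.Nullary using (Dec; yes; no; ¬_; _×-dec_)
open import Relation.Binary.PropositionalEquality using (_≡_; _≢_; refl; sym; trans; cong; cong₂; subst; subst₂; module ≡-Reasoning)
open import Data.Empty using (⊥-elim)
open import Data.List.Membership.Propositional using (_∈_; _∉_)
open import Data.List.Membership.Propositional.Properties using (∈-allFin)
open import Data.List.Relation.Unary.Any using (here; there)
import Data.List.Relation.Unary.All as All
open import Data.List.Relation.Unary.Unique.Propositional using (Unique)
open import Data.List.Relation.Unary.AllPairs using (_∷_)
open import Data.List.Relation.Unary.Unique.Propositional.Properties using (allFin⁺)
open import Algebra.Properties.Semiring.Sum +-*-semiring
  using (sum-syntax; sum-cong-≗; ∑-distrib-+; ∑-comm; *-distribˡ-sum)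
open import Data.Nat.Tactic.RingSolver using (solve-∀)

-- Finite sums and counting

∑-const : ∀ n c → ∑[ i < n ] c ≡ n * c
∑-const zero    c = refl
∑-const (suc n) c = cong (c +_) (∑-const n c)

∑-combine : ∀ m n (f : Fin (m * n) → ℕ) →
  ∑[ x < m * n ] f x ≡ ∑[ q < m ] ∑[ r < n ] f (combine q r)
∑-combine zero    n f = refl
∑-combine (suc m) n f = trans (∑-append n (m * n) f)
  (cong (∑[ r < n ] f (r ↑ˡ (m * n)) +_) (∑-combine m n (λ x → f (n ↑ʳ x))))
  where
  ∑-append : ∀ a b (g : Fin (a + b) → ℕ) →
    ∑[ x < a + b ] g x ≡ ∑[ i < a ] g (i ↑ˡ b) + ∑[ j < b ] g (a ↑ʳ j)
  ∑-append zero    b g = refl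
  ∑-append (suc a) b g =
    trans (cong (g zero +_) (∑-append a b (λ x → g (suc x)))) (sym (+-assoc (g zero) _ _))

listSum-allFin : ∀ n (f : Fin n → ℕ) → List.sum (map f (allFin n)) ≡ ∑[ i < n ] f i
listSum-allFin n f = trans (cong List.sum (map-tabulate (λ x → x) f)) (listSum-tabulate n f)
  where
  listSum-tabulate : ∀ n (f : Fin n → ℕ) → List.sum (tabulate f) ≡ ∑[ i < n ] f i
  listSum-tabulate zero    f = refl
  listSum-tabulate (suc n) f = cong (f zero +_) (listSum-tabulate n (λ i → f (suc i)))

⟦_⟧ : {A : Set} → Dec A → ℕ
⟦ yes _ ⟧ = 1
⟦ no  _ ⟧ = 0

⟦⟧-yes : {A : Set} (a? : Dec A) → A → ⟦ a? ⟧ ≡ 1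
⟦⟧-yes (yes _) _ = refl
⟦⟧-yes (no ¬a) a = ⊥-elim (¬a a)

⟦⟧-no : {A : Set} (a? : Dec A) → ¬ A → ⟦ a? ⟧ ≡ 0
⟦⟧-no (yes a) ¬a = ⊥-elim (¬a a)
⟦⟧-no (no _)  _  = refl

⟦⟧-cong : {A B : Set} (a? : Dec A) (b? : Dec B) → (A → B) → (B → A) → ⟦ a? ⟧ ≡ ⟦ b? ⟧
⟦⟧-cong (yes a) b? f g = sym (⟦⟧-yes b? (f a))
⟦⟧-cong (no ¬a) b? f g = sym (⟦⟧-no b? (λ b → ¬a (g b)))

⟦⟧-×-yes : {A B : Set} (a? : Dec A) (b? : Dec B) → A → ⟦ a? ×-dec b? ⟧ ≡ ⟦ b? ⟧
⟦⟧-×-yes (yes _) (yes _) _ = refl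
⟦⟧-×-yes (yes _) (no _)  _ = refl
⟦⟧-×-yes (no ¬a) b?      a = ⊥-elim (¬a a)

⟦⟧-×-no : {A B : Set} (a? : Dec A) (b? : Dec B) → ¬ A → ⟦ a? ×-dec b? ⟧ ≡ 0
⟦⟧-×-no (yes a) b? ¬a = ⊥-elim (¬a a)
⟦⟧-×-no (no _)  b? _  = refl

count-allFin : ∀ n {P : Fin n → Set} (P? : ∀ x → Dec (P x)) →
  length (filter P? (allFin n)) ≡ ∑[ x < n ] ⟦ P? x ⟧
count-allFin n P? = trans (count-list (allFin n)) (listSum-allFin n (λ x → ⟦ P? x ⟧))
  where
  count-list : ∀ xs → length (filter P? xs) ≡ List.sum (map (λ x → ⟦ P? x ⟧) xs)
  count-list []       = refl
  count-list (x ∷ xs) with P? x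
  ... | yes _ = cong suc (count-list xs)
  ... | no  _ = count-list xs

count-below : ∀ n e → e ≤ n → ∑[ q < n ] ⟦ toℕ q <? e ⟧ ≡ e
count-below zero    zero    _ = refl
count-below (suc n) zero    _ =
  trans (sum-cong-≗ {suc n} (λ q → ⟦⟧-no (toℕ q <? 0) (λ ()))) (trans (∑-const (suc n) 0) (*-zeroʳ n))
count-below (suc n) (suc e) (s≤s e≤n) = cong₂ _+_ (⟦⟧-yes (0 <? suc e) (s≤s z≤n))
  (trans (sum-cong-≗ {n} (λ q → ⟦⟧-cong (suc (toℕ q) <? suc e) (toℕ q <? e) s<s⁻¹ s≤s))
    (count-below n e e≤n))

^ᶠ-comm : {A : Set} (f : A → A) (a b : ℕ) (x : A) → (f ^ᶠ a) ((f ^ᶠ b) x) ≡ (f ^ᶠ b) ((f ^ᶠ a) x)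
^ᶠ-comm f a b x = trans (sym (^ᶠ-+ b a x)) (trans (cong (λ c → (f ^ᶠ c) x) (+-comm b a)) (^ᶠ-+ a b x))
  where
  ^ᶠ-+ : ∀ a b x → (f ^ᶠ (a + b)) x ≡ (f ^ᶠ b) ((f ^ᶠ a) x)
  ^ᶠ-+ zero    b x = refl
  ^ᶠ-+ (suc a) b x = ^ᶠ-+ a b (f x)

^ᶠ-natural : {A B : Set} (h : A → B) (f : B → B) (g : A → A) → (∀ x → f (h x) ≡ h (g x)) →
  ∀ e x → (f ^ᶠ e) (h x) ≡ h ((g ^ᶠ e) x)
^ᶠ-natural h f g hg zero    x = refl
^ᶠ-natural h f g hg (suc e) x = trans (cong (f ^ᶠ e) (hg x)) (^ᶠ-natural h f g hg e (g x))

^ᶠ-fixed : {A : Set} (f : A → A) (x : A) → f x ≡ x → ∀ e → (f ^ᶠ e) x ≡ x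
^ᶠ-fixed f x fx≡x zero    = refl
^ᶠ-fixed f x fx≡x (suc e) = trans (cong (f ^ᶠ e) fx≡x) (^ᶠ-fixed f x fx≡x e)

-- The cyclic predecessor on Fin (suc d′)

module CyclicPredecessor (d′ : ℕ) where

  cpred : Fin (suc d′) → Fin (suc d′)
  cpred zero    = fromℕ d′
  cpred (suc q) = inject₁ q

  cpred^ : ℕ → Fin (suc d′) → Fin (suc d′)
  cpred^ e = cpred ^ᶠ e

  cpred^-≥ : ∀ e q → e ≤ toℕ q → toℕ (cpred^ e q) + e ≡ toℕ q
  cpred^-≥ zero    q       _         = +-identityʳ (toℕ q)
  cpred^-≥ (suc e) (suc q) (s≤s e≤q) = trans (+-suc _ e) (cong suc (begin
    toℕ (cpred^ e (inject₁ q)) + e ≡⟨ cpred^-≥ e (inject₁ q) (subst (e ≤_) (sym (toℕ-inject₁ q)) e≤q) ⟩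
    toℕ (inject₁ q)                ≡⟨ toℕ-inject₁ q ⟩
    toℕ q                          ∎))
    where open ≡-Reasoning

  cpred^-< : ∀ e q → e ≤ suc d′ → toℕ q < e → toℕ (cpred^ e q) + e ≡ toℕ q + suc d′
  cpred^-< (suc e) zero (s≤s e≤d′) _ = trans (+-suc _ e) (cong suc (begin
    toℕ (cpred^ e (fromℕ d′)) + e ≡⟨ cpred^-≥ e (fromℕ d′) (subst (e ≤_) (sym (toℕ-fromℕ d′)) e≤d′) ⟩
    toℕ (fromℕ d′)                ≡⟨ toℕ-fromℕ d′ ⟩
    d′                            ∎))
    where open ≡-Reasoning
  cpred^-< (suc e) (suc q) 1+e≤D (s≤s q<e) = trans (+-suc _ e) (cong suc (begin
    toℕ (cpred^ e (inject₁ q)) + e ≡⟨ cpred^-< e (inject₁ q) (≤-trans (n≤1+n e) 1+e≤D)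
                                        (subst (_< e) (sym (toℕ-inject₁ q)) q<e) ⟩
    toℕ (inject₁ q) + suc d′       ≡⟨ cong (_+ suc d′) (toℕ-inject₁ q) ⟩
    toℕ q + suc d′                 ∎))
    where open ≡-Reasoning

  cpred^-zero : ∀ e → 0 < e → e ≤ suc d′ → toℕ (cpred^ e zero) + e ≡ suc d′
  cpred^-zero e 0<e e≤D = cpred^-< e zero e≤D 0<e

  exponent : Fin (suc d′) → Fin (suc d′)
  exponent zero    = zero
  exponent (suc q) = suc (opposite q)

  exponent-spec : ∀ q → cpred^ (toℕ (exponent q)) zero ≡ q
  exponent-spec zero    = refl
  exponent-spec (suc q) = toℕ-injective (+-cancelʳ-≡ e _ _ (begin
    toℕ (cpred^ e zero) + e                ≡⟨ cpred^-zero e (s≤s z≤n) (m≤n⇒m≤1+n (toℕ<n (opposite q))) ⟩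
    suc d′                                 ≡⟨ cong suc (m+[n∸m]≡n (toℕ<n q)) ⟨
    suc (suc (toℕ q) + (d′ ∸ suc (toℕ q))) ≡⟨ +-suc (suc (toℕ q)) _ ⟨
    suc (toℕ q) + suc (d′ ∸ suc (toℕ q))   ≡⟨ cong (λ z → suc (toℕ q) + suc z) (opposite-prop q) ⟨
    suc (toℕ q) + e                        ∎))
    where
    open ≡-Reasoning
    e = suc (toℕ (opposite q))

  cpred^-suc-≢-zero : ∀ (c : Fin d′) → cpred^ (suc (toℕ c)) zero ≢ zero
  cpred^-suc-≢-zero c eq = <-irrefl (suc-injective (begin
    suc (toℕ c)                                   ≡⟨⟩
    toℕ {suc d′} zero + suc (toℕ c)               ≡⟨ cong (λ z → toℕ z + suc (toℕ c)) eq ⟨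
    toℕ (cpred^ (suc (toℕ c)) zero) + suc (toℕ c) ≡⟨ cpred^-zero (suc (toℕ c)) (s≤s z≤n) (s≤s (<⇒≤ (toℕ<n c))) ⟩
    suc d′                                        ∎)) (toℕ<n c)
    where open ≡-Reasoning

  cpred^-zero-injective : ∀ (a b : Fin (suc d′)) → cpred^ (toℕ a) zero ≡ cpred^ (toℕ b) zero → a ≡ b
  cpred^-zero-injective zero    zero    _  = refl
  cpred^-zero-injective zero    (suc b) eq = ⊥-elim (cpred^-suc-≢-zero b (sym eq))
  cpred^-zero-injective (suc a) zero    eq = ⊥-elim (cpred^-suc-≢-zero a eq)
  cpred^-zero-injective (suc a) (suc b) eq = toℕ-injective (+-cancelˡ-≡ (toℕ (cpred^ (toℕ (suc a)) zero)) _ _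
    (trans (lands a) (sym (trans (cong (λ z → toℕ z + toℕ (suc b)) eq) (lands b)))))
    where
    lands : ∀ c → toℕ (cpred^ (toℕ (suc c)) zero) + toℕ (suc c) ≡ suc d′
    lands c = cpred^-zero (toℕ (suc c)) (s≤s z≤n) (s≤s (<⇒≤ (toℕ<n c)))

-- Coordinates on [n] = Fin (d * k)

module Coordinates (d′ k′ : ℕ) where

  open CyclicPredecessor d′ public

  D K : ℕ
  D = suc d′
  K = suc k′

  point : Fin D → Fin K → Fin (D * K)
  point = combine

  point-%-DK : ∀ (q : Fin D) (r : Fin K) → toℕ (point q r) % (D * K) ≡ toℕ (point q r)
  point-%-DK q r = m<n⇒m%n≡m (toℕ<n (point q r))

  point-%-K : ∀ (q : Fin D) (r : Fin K) → toℕ (point q r) % K ≡ toℕ r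
  point-%-K q r = begin
    toℕ (point q r) % K     ≡⟨ cong (_% K) (trans (toℕ-combine q r) (+-comm (K * toℕ q) (toℕ r))) ⟩
    (toℕ r + K * toℕ q) % K ≡⟨ cong (λ z → (toℕ r + z) % K) (*-comm K (toℕ q)) ⟩
    (toℕ r + toℕ q * K) % K ≡⟨ [m+kn]%n≡m%n (toℕ r) (toℕ q) K ⟩
    toℕ r % K               ≡⟨ m<n⇒m%n≡m (toℕ<n r) ⟩
    toℕ r                   ∎
    where open ≡-Reasoning

  toℕ-τ : ∀ x → toℕ (τ D K x) ≡ (toℕ x + d′ * K) % (D * K)
  toℕ-τ x = trans (toℕ-fromℕ< _) (cong (λ m → (toℕ x + m) % (D * K)) (m+n∸m≡n K (d′ * K)))

  τ-point : ∀ (q : Fin D) (r : Fin K) → τ D K (point q r) ≡ point (cpred q) r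
  τ-point zero r = toℕ-injective (begin
    toℕ (τ D K (point zero r))              ≡⟨ toℕ-τ (point zero r) ⟩
    (toℕ (point zero r) + d′ * K) % (D * K) ≡⟨ cong (_% (D * K)) to-last-row ⟩
    toℕ (point (fromℕ d′) r) % (D * K)      ≡⟨ point-%-DK (fromℕ d′) r ⟩
    toℕ (point (fromℕ d′) r)                ∎)
    where
    open ≡-Reasoning
    to-last-row : toℕ (point zero r) + d′ * K ≡ toℕ (point (fromℕ d′) r)
    to-last-row = begin
      toℕ (point zero r) + d′ * K ≡⟨ cong (_+ d′ * K) (toℕ-combine {D} zero r) ⟩
      K * 0 + toℕ r + d′ * K      ≡⟨ arith K (toℕ r) d′ ⟩
      K * d′ + toℕ r              ≡⟨ cong (λ z → K * z + toℕ r) (toℕ-fromℕ d′) ⟨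
      K * toℕ (fromℕ d′) + toℕ r  ≡⟨ toℕ-combine (fromℕ d′) r ⟨
      toℕ (point (fromℕ d′) r)    ∎
      where
      arith : ∀ k r d → k * 0 + r + d * k ≡ k * d + r
      arith = solve-∀
  τ-point (suc q) r = toℕ-injective (begin
    toℕ (τ D K (point (suc q) r))                 ≡⟨ toℕ-τ (point (suc q) r) ⟩
    (toℕ (point (suc q) r) + d′ * K) % (D * K)    ≡⟨ cong (_% (D * K)) to-previous-row ⟩
    (toℕ (point (inject₁ q) r) + D * K) % (D * K) ≡⟨ [m+n]%n≡m%n (toℕ (point (inject₁ q) r)) (D * K) ⟩
    toℕ (point (inject₁ q) r) % (D * K)           ≡⟨ point-%-DK (inject₁ q) r ⟩
    toℕ (point (inject₁ q) r)                     ∎)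
    where
    open ≡-Reasoning
    to-previous-row : toℕ (point (suc q) r) + d′ * K ≡ toℕ (point (inject₁ q) r) + D * K
    to-previous-row = begin
      toℕ (point (suc q) r) + d′ * K        ≡⟨ cong (_+ d′ * K) (toℕ-combine (suc q) r) ⟩
      K * suc (toℕ q) + toℕ r + d′ * K      ≡⟨ arith K (toℕ q) (toℕ r) d′ ⟩
      (K * toℕ q + toℕ r) + suc d′ * K      ≡⟨ cong (λ z → K * z + toℕ r + D * K) (toℕ-inject₁ q) ⟨
      (K * toℕ (inject₁ q) + toℕ r) + D * K ≡⟨ cong (_+ D * K) (toℕ-combine (inject₁ q) r) ⟨
      toℕ (point (inject₁ q) r) + D * K     ∎
      where
      arith : ∀ k q r d → k * suc q + r + d * k ≡ (k * q + r) + suc d * k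
      arith = solve-∀

  τ^-point : ∀ j (q : Fin D) (r : Fin K) → (τ D K ^ᶠ j) (point q r) ≡ point (cpred^ j q) r
  τ^-point j q r = ^ᶠ-natural (λ p → point p r) (τ D K) cpred (λ p → τ-point p r) j q

  τᵢ-own : ∀ (q : Fin D) (r : Fin K) → τᵢ D K r (point q r) ≡ point (cpred q) r
  τᵢ-own q r with toℕ (point q r) % K ≟ℕ toℕ r
  ... | yes _  = τ-point q r
  ... | no  ≢r = ⊥-elim (≢r (point-%-K q r))

  τᵢ-other : ∀ (q : Fin D) (r r′ : Fin K) → r′ ≢ r → τᵢ D K r (point q r′) ≡ point q r′
  τᵢ-other q r r′ r′≢r with toℕ (point q r′) % K ≟ℕ toℕ r
  ... | yes ≡r = ⊥-elim (r′≢r (toℕ-injective (trans (sym (point-%-K q r′)) ≡r)))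
  ... | no  _  = refl

  columnShifts : (Fin K → Fin D) → List (Fin K) → Fin (D * K) → Fin (D * K)
  columnShifts e = foldr (λ r acc → (τᵢ D K r ^ᶠ toℕ (e r)) ⨾ acc) (λ x → x)

  columnShifts-∉ : ∀ e L (q : Fin D) (r : Fin K) → r ∉ L → columnShifts e L (point q r) ≡ point q r
  columnShifts-∉ e []      q r _   = refl
  columnShifts-∉ e (s ∷ L) q r r∉ = trans
    (cong (columnShifts e L) (^ᶠ-fixed (τᵢ D K s) _ (τᵢ-other q s r (λ r≡s → r∉ (here r≡s))) (toℕ (e s))))
    (columnShifts-∉ e L q r (λ r∈L → r∉ (there r∈L)))

  columnShifts-∈ : ∀ e L (q : Fin D) (r : Fin K) → Unique L → r ∈ L →
    columnShifts e L (point q r) ≡ point (cpred^ (toℕ (e r)) q) r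
  columnShifts-∈ e (s ∷ L) q .s (s∉L ∷ _) (here refl) = trans
    (cong (columnShifts e L) (^ᶠ-natural (λ p → point p s) (τᵢ D K s) cpred (λ p → τᵢ-own p s) (toℕ (e s)) q))
    (columnShifts-∉ e L (cpred^ (toℕ (e s)) q) s (λ s∈L → All.lookup s∉L s∈L refl))
  columnShifts-∈ e (s ∷ L) q r (s∉L ∷ uL) (there r∈L) = trans
    (cong (columnShifts e L) (^ᶠ-fixed (τᵢ D K s) _ (τᵢ-other q s r (λ r≡s → All.lookup s∉L r∈L (sym r≡s))) (toℕ (e s))))
    (columnShifts-∈ e L q r uL r∈L)

  hat-point : ∀ ρ (q : Fin D) (r : Fin K) → hat D K ρ (point q r) ≡ point q (ρ ⟨$⟩ʳ r)
  hat-point ρ q r = cong (λ p → point (proj₁ p) (ρ ⟨$⟩ʳ proj₂ p)) (remQuot-combine {D} {K} q r)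

  decomp-point : ∀ e ρ (q : Fin D) (r : Fin K) →
    decomp D K e ρ (point q r) ≡ point (cpred^ (toℕ (e r)) q) (ρ ⟨$⟩ʳ r)
  decomp-point e ρ q r = trans
    (cong (hat D K ρ) (columnShifts-∈ e (allFin K) q r (allFin⁺ K) (∈-allFin r)))
    (hat-point ρ (cpred^ (toℕ (e r)) q) r)

  -- The data (e , ρ) are determined by the permutation τ_1^{e_1} ⋯ τ_k^{e_k} ρ̂:
  -- its values on the row q = 0 already recover them.
  decomp-injective : ∀ e ρ e′ ρ′ → (∀ x → decomp D K e ρ x ≡ decomp D K e′ ρ′ x) →
    (∀ r → ρ ⟨$⟩ʳ r ≡ ρ′ ⟨$⟩ʳ r) × (∀ r → e r ≡ e′ r)
  decomp-injective e ρ e′ ρ′ same =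
    (λ r → proj₂ (row₀ r)) , (λ r → cpred^-zero-injective (e r) (e′ r) (proj₁ (row₀ r)))
    where
    row₀ : ∀ r → cpred^ (toℕ (e r)) zero ≡ cpred^ (toℕ (e′ r)) zero × ρ ⟨$⟩ʳ r ≡ ρ′ ⟨$⟩ʳ r
    row₀ r = combine-injective _ _ _ _ (trans (sym (decomp-point e ρ zero r))
      (trans (same (point zero r)) (decomp-point e′ ρ′ zero r)))

  Commutes : (Fin (D * K) → Fin (D * K)) → Set
  Commutes π = ∀ x → τ D K (π x) ≡ π (τ D K x)

  inverse-commutes : (σ : Permutation′ (D * K)) → InCentralizer D K σ → Commutes (σ ⟨$⟩ˡ_)
  inverse-commutes σ στ≡τσ x = begin
    τ D K (σ⁻¹ x)              ≡⟨ inverseˡ σ ⟨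
    σ⁻¹ (σ ⟨$⟩ʳ τ D K (σ⁻¹ x)) ≡⟨ cong σ⁻¹ (στ≡τσ (σ⁻¹ x)) ⟨
    σ⁻¹ (τ D K (σ ⟨$⟩ʳ σ⁻¹ x)) ≡⟨ cong (λ y → σ⁻¹ (τ D K y)) (inverseʳ σ) ⟩
    σ⁻¹ (τ D K x)              ∎
    where
    open ≡-Reasoning
    σ⁻¹ : Fin (D * K) → Fin (D * K)
    σ⁻¹ y = σ ⟨$⟩ˡ y

  -- A map π commuting with τ is determined by the images of the row q = 0:
  -- writing (0 , r) π = (0 - shift r , column r), it is (q , r) ↦ (q - shift r , column r).
  module CommutingMap (π : Fin (D * K) → Fin (D * K)) (πτ≡τπ : Commutes π) where

    row : Fin K → Fin D
    row r = proj₁ (remQuot {D} K (π (point zero r)))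

    column : Fin K → Fin K
    column r = proj₂ (remQuot {D} K (π (point zero r)))

    shift : Fin K → Fin D
    shift r = exponent (row r)

    π-row₀ : ∀ r → π (point zero r) ≡ point (cpred^ (toℕ (shift r)) zero) (column r)
    π-row₀ r = begin
      π (point zero r)         ≡⟨ combine-remQuot {D} K _ ⟨
      point (row r) (column r) ≡⟨ cong (λ q → point q (column r)) (exponent-spec (row r)) ⟨
      point (cpred^ (toℕ (shift r)) zero) (column r) ∎
      where open ≡-Reasoning

    π-point : ∀ (q : Fin D) (r : Fin K) → π (point q r) ≡ point (cpred^ (toℕ (shift r)) q) (column r)
    π-point q r = begin
      π (point q r)                                   ≡⟨ cong (λ p → π (point p r)) (exponent-spec q) ⟨
      π (point (cpred^ m zero) r)                     ≡⟨ cong π (τ^-point m zero r) ⟨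
      π ((τ D K ^ᶠ m) (point zero r))                 ≡⟨ ^ᶠ-natural π (τ D K) (τ D K) πτ≡τπ m _ ⟨
      (τ D K ^ᶠ m) (π (point zero r))                 ≡⟨ cong (τ D K ^ᶠ m) (π-row₀ r) ⟩
      (τ D K ^ᶠ m) (point (cpred^ e zero) (column r)) ≡⟨ τ^-point m _ (column r) ⟩
      point (cpred^ m (cpred^ e zero)) (column r)     ≡⟨ cong (λ p → point p (column r)) (^ᶠ-comm cpred m e zero) ⟩
      point (cpred^ e (cpred^ m zero)) (column r)     ≡⟨ cong (λ p → point (cpred^ e p) (column r)) (exponent-spec q) ⟩
      point (cpred^ e q) (column r)                   ∎
      where
      open ≡-Reasoning
      m = toℕ (exponent q)
      e = toℕ (shift r)

  open CommutingMap using (column; shift; π-row₀; π-point)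

  column-inverse : ∀ π π′ (c : Commutes π) (c′ : Commutes π′) → (∀ x → π (π′ x) ≡ x) →
    ∀ r → column π c (column π′ c′ r) ≡ r
  column-inverse π π′ c c′ ππ′≡id r = proj₂ (combine-injective q r′ zero r (begin
    point q r′                    ≡⟨ π-point π c q′ (column π′ c′ r) ⟨
    π (point q′ (column π′ c′ r)) ≡⟨ cong π (π-row₀ π′ c′ r) ⟨
    π (π′ (point zero r))         ≡⟨ ππ′≡id (point zero r) ⟩
    point zero r                  ∎))
    where
    open ≡-Reasoning
    q′ q : Fin D
    q′ = cpred^ (toℕ (shift π′ c′ r)) zero
    q  = cpred^ (toℕ (shift π c (column π′ c′ r))) q′
    r′ : Fin K
    r′ = column π c (column π′ c′ r)

  centralizer-decomp : (σ : Permutation′ (D * K)) → InCentralizer D K σ →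
    Σ (Permutation′ K) λ ρ → Σ (Fin K → Fin D) λ e → ∀ x → σ ⟨$⟩ʳ x ≡ decomp D K e ρ x
  centralizer-decomp σ στ≡τσ = ρ , shift σ→ στ≡τσ , agrees
    where
    σ→ σ← : Fin (D * K) → Fin (D * K)
    σ→ x = σ ⟨$⟩ʳ x
    σ← x = σ ⟨$⟩ˡ x
    σ←τ≡τσ← = inverse-commutes σ στ≡τσ
    ρ : Permutation′ K
    ρ = permutation (column σ→ στ≡τσ) (column σ← σ←τ≡τσ←)
      (column-inverse σ→ σ← στ≡τσ σ←τ≡τσ← (λ _ → inverseʳ σ))
      (column-inverse σ← σ→ σ←τ≡τσ← στ≡τσ (λ _ → inverseˡ σ))
    agrees : ∀ x → σ ⟨$⟩ʳ x ≡ decomp D K (shift σ→ στ≡τσ) ρ x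
    agrees x with q , r , refl ← combine-surjective {D} {K} x =
      trans (π-point σ→ στ≡τσ q r) (sym (decomp-point (shift σ→ στ≡τσ) ρ q r))

  same-row-< : ∀ (q : Fin D) (r s : Fin K) → ⟦ toℕ (point q r) <? toℕ (point q s) ⟧ ≡ ⟦ toℕ r <? toℕ s ⟧
  same-row-< q r s = ⟦⟧-cong (toℕ (point q r) <? toℕ (point q s)) (toℕ r <? toℕ s)
    (λ lt → +-cancelˡ-< (K * toℕ q) (toℕ r) (toℕ s) (subst₂ _<_ (toℕ-combine q r) (toℕ-combine q s) lt))
    (λ lt → subst₂ _<_ (sym (toℕ-combine q r)) (sym (toℕ-combine q s)) (+-monoʳ-< (K * toℕ q) lt))

  shifted-row-< : ∀ (e q : Fin D) (r s : Fin K) → 0 < toℕ e →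
    ⟦ toℕ (point q r) <? toℕ (point (cpred^ (toℕ e) q) s) ⟧ ≡ ⟦ toℕ q <? toℕ e ⟧
  shifted-row-< e q r s 0<e = ⟦⟧-cong (toℕ (point q r) <? toℕ (point q′ s)) (toℕ q <? toℕ e) raised⇒wraps wraps⇒raised
    where
    q′ : Fin D
    q′ = cpred^ (toℕ e) q
    wraps⇒raised : toℕ q < toℕ e → toℕ (point q r) < toℕ (point q′ s)
    wraps⇒raised q<e = combine-monoˡ-< r s (+-cancelʳ-< D (toℕ q) (toℕ q′) (begin-strict
      toℕ q + D      ≡⟨ cpred^-< (toℕ e) q (<⇒≤ (toℕ<n e)) q<e ⟨
      toℕ q′ + toℕ e <⟨ +-monoʳ-< (toℕ q′) (toℕ<n e) ⟩
      toℕ q′ + D     ∎))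
      where open ≤-Reasoning
    raised⇒wraps : toℕ (point q r) < toℕ (point q′ s) → toℕ q < toℕ e
    raised⇒wraps raised with toℕ q <? toℕ e
    ... | yes q<e = q<e
    ... | no  q≮e = ⊥-elim (<-asym raised (combine-monoˡ-< s r (begin-strict
      toℕ q′         <⟨ m<m+n (toℕ q′) 0<e ⟩
      toℕ q′ + toℕ e ≡⟨ cpred^-≥ (toℕ e) q (≮⇒≥ q≮e) ⟩
      toℕ q          ∎)))
      where open ≤-Reasoning

  column-excedances : (e : Fin D) (r s : Fin K) →
    ∑[ q < D ] ⟦ toℕ (point q r) <? toℕ (point (cpred^ (toℕ e) q) s) ⟧
      ≡ D * ⟦ (toℕ e ≟ℕ 0) ×-dec (toℕ r <? toℕ s) ⟧ + toℕ e
  column-excedances zero r s = begin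
    ∑[ q < D ] ⟦ toℕ (point q r) <? toℕ (point q s) ⟧ ≡⟨ sum-cong-≗ {D} (λ q → same-row-< q r s) ⟩
    ∑[ q < D ] ⟦ toℕ r <? toℕ s ⟧                     ≡⟨ ∑-const D _ ⟩
    D * ⟦ toℕ r <? toℕ s ⟧                            ≡⟨ cong (D *_) (⟦⟧-×-yes (0 ≟ℕ 0) (toℕ r <? toℕ s) refl) ⟨
    D * ⟦ (0 ≟ℕ 0) ×-dec (toℕ r <? toℕ s) ⟧           ≡⟨ +-identityʳ _ ⟨
    D * ⟦ (0 ≟ℕ 0) ×-dec (toℕ r <? toℕ s) ⟧ + 0       ∎
    where open ≡-Reasoning
  column-excedances (suc e) r s = begin
    ∑[ q < D ] ⟦ toℕ (point q r) <? toℕ (point (cpred^ (toℕ (suc e)) q) s) ⟧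
      ≡⟨ sum-cong-≗ {D} (λ q → shifted-row-< (suc e) q r s (s≤s z≤n)) ⟩
    ∑[ q < D ] ⟦ toℕ q <? toℕ (suc e) ⟧
      ≡⟨ count-below D (toℕ (suc e)) (<⇒≤ (toℕ<n (suc e))) ⟩
    toℕ (suc e)
      ≡⟨ cong (_+ toℕ (suc e)) no-fixed-column ⟨
    D * ⟦ (toℕ (suc e) ≟ℕ 0) ×-dec (toℕ r <? toℕ s) ⟧ + toℕ (suc e)
      ∎
    where
    open ≡-Reasoning
    no-fixed-column : D * ⟦ (toℕ (suc e) ≟ℕ 0) ×-dec (toℕ r <? toℕ s) ⟧ ≡ 0
    no-fixed-column = trans (cong (D *_) (⟦⟧-×-no (toℕ (suc e) ≟ℕ 0) (toℕ r <? toℕ s) (λ ()))) (*-zeroʳ D)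

  exc-decomp : ∀ (σ : Permutation′ (D * K)) e ρ → (∀ x → σ ⟨$⟩ʳ x ≡ decomp D K e ρ x) →
    exc (D * K) σ ≡ D * E₀ D K e ρ + sumE D K e
  exc-decomp σ e ρ σ≡ = begin
    exc (D * K) σ
      ≡⟨ count-allFin (D * K) excedance? ⟩
    ∑[ x < D * K ] ⟦ excedance? x ⟧
      ≡⟨ ∑-combine D K (λ x → ⟦ excedance? x ⟧) ⟩
    ∑[ q < D ] ∑[ r < K ] ⟦ excedance? (point q r) ⟧
      ≡⟨ ∑-comm (λ q r → ⟦ excedance? (point q r) ⟧) ⟩
    ∑[ r < K ] ∑[ q < D ] ⟦ excedance? (point q r) ⟧
      ≡⟨ sum-cong-≗ {K} (λ r → sum-cong-≗ {D} (λ q → by-★ q r)) ⟩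
    ∑[ r < K ] ∑[ q < D ] ⟦ toℕ (point q r) <? toℕ (point (cpred^ (toℕ (e r)) q) (ρ ⟨$⟩ʳ r)) ⟧
      ≡⟨ sum-cong-≗ {K} (λ r → column-excedances (e r) r (ρ ⟨$⟩ʳ r)) ⟩
    ∑[ r < K ] (D * fixedExc r + toℕ (e r))
      ≡⟨ ∑-distrib-+ (λ r → D * fixedExc r) (λ r → toℕ (e r)) ⟩
    ∑[ r < K ] (D * fixedExc r) + ∑[ r < K ] toℕ (e r)
      ≡⟨ cong (_+ ∑[ r < K ] toℕ (e r)) (*-distribˡ-sum D fixedExc) ⟨
    D * ∑[ r < K ] fixedExc r + ∑[ r < K ] toℕ (e r)
      ≡⟨ cong₂ (λ a b → D * a + b) (count-allFin K fixedExc?) (listSum-allFin K (λ r → toℕ (e r))) ⟨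
    D * E₀ D K e ρ + sumE D K e
      ∎
    where
    open ≡-Reasoning
    excedance? : ∀ x → Dec (toℕ x < toℕ (σ ⟨$⟩ʳ x))
    excedance? x = toℕ x <? toℕ (σ ⟨$⟩ʳ x)
    fixedExc? : ∀ r → Dec (toℕ (e r) ≡ 0 × toℕ r < toℕ (ρ ⟨$⟩ʳ r))
    fixedExc? r = (toℕ (e r) ≟ℕ 0) ×-dec (toℕ r <? toℕ (ρ ⟨$⟩ʳ r))
    fixedExc : Fin K → ℕ
    fixedExc r = ⟦ fixedExc? r ⟧
    by-★ : ∀ q r → ⟦ excedance? (point q r) ⟧ ≡ ⟦ toℕ (point q r) <? toℕ (point (cpred^ (toℕ (e r)) q) (ρ ⟨$⟩ʳ r)) ⟧
    by-★ q r = cong (λ y → ⟦ toℕ (point q r) <? toℕ y ⟧) (trans (σ≡ (point q r)) (decomp-point e ρ q r))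

lemma5p4 : (d k : ℕ) .{{_ : NonZero d}} .{{_ : NonZero k}} →
    (σ : Permutation′ (d * k)) → InCentralizer d k σ →
    Σ (Permutation′ k) λ ρ → Σ (Fin k → Fin d) λ e →
      ((∀ x → σ ⟨$⟩ʳ x ≡ decomp d k e ρ x)
      × (∀ (ρ′ : Permutation′ k) (e′ : Fin k → Fin d) →
           (∀ x → σ ⟨$⟩ʳ x ≡ decomp d k e′ ρ′ x) →
           (∀ r → ρ ⟨$⟩ʳ r ≡ ρ′ ⟨$⟩ʳ r) × (∀ r → e r ≡ e′ r)))
      × exc (d * k) σ ≡ d * E₀ d k e ρ + sumE d k e
lemma5p4 (suc d′) (suc k′) σ στ≡τσ = ρ , e , (σ≡ , unique) , exc-decomp σ e ρ σ≡
  where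
  open Coordinates d′ k′
  ρ : Permutation′ K
  ρ = proj₁ (centralizer-decomp σ στ≡τσ)
  e : Fin K → Fin D
  e = proj₁ (proj₂ (centralizer-decomp σ στ≡τσ))
  σ≡ : ∀ x → σ ⟨$⟩ʳ x ≡ decomp D K e ρ x
  σ≡ = proj₂ (proj₂ (centralizer-decomp σ στ≡τσ))
  unique : ∀ ρ′ e′ → (∀ x → σ ⟨$⟩ʳ x ≡ decomp D K e′ ρ′ x) →
    (∀ r → ρ ⟨$⟩ʳ r ≡ ρ′ ⟨$⟩ʳ r) × (∀ r → e r ≡ e′ r)
  unique ρ′ e′ σ≡′ = decomp-injective e ρ e′ ρ′ (λ x → trans (sym (σ≡ x)) (σ≡′ x))
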